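{- Let $M=\langle W,\mathcal{N},V\rangle$ be a gtn-model and let $\mu=\{X\subseteq\bigcup\mathcal{N}: \text{for all } w\in X,\ X\in\mathcal{N}_w\}$. Then $\bigcup\mu=\bigcup\mathcal{N}$, where $\bigcup\mu$ is the union of all members of $\mu$.
   Context: A gtn-model is $\langle W,\mathcal{N},V\rangle$ with $W$ nonempty, $V$ a map from propositional variables to $P(W)$ and $\mathcal{N}:W\to P(P(W))$ such that, writing $\bigcup\mathcal{N}$ for the union of all sets $X$ with $X\in\mathcal{N}_w$ for some $w\in W$: (1) $W=W_1\cup W_2$ where $W_1=\{z\in W: z\in\bigcap\mathcal{N}_z\}$ and $W_2=\{z\in W:z\notin\bigcup\mathcal{N}\}$, where $z\in\bigcap\mathcal{N}_z$ means that $\mathcal{N}_z\neq\emptyset$ and $z$ belongs to every member of $\mathcal{N}_z$; (2) if $X\in\mathcal{N}_w$ and $X\subseteq Y\subseteq\bigcup\mathcal{N}$ then $Y\in\mathcal{N}_w$; (3) if $X\in\mathcal{N}_w$ then $\{z\in W_1: X\in\mathcal{N}_z\}\in\mathcal{N}_w$. -}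

module Defs where

open import Level using (0ℓ)
open import Data.Nat using (ℕ)
open import Data.Product using (Σ; _×_; ∃; ∃-syntax)
open import Data.Sum using (_⊎_)
open import Relation.Nullary using (¬_)
open import Relation.Unary using (Pred; _∈_; _∉_; _⊆_; _≐_)

Subset : Set → Set₁
Subset W = Pred W 0ℓ

PropVar : Set
PropVar = ℕ

Nbhd : Set → Set₂
Nbhd W = W → Pred (Subset W) (Level.suc 0ℓ)

module _ {W : Set} (N : Nbhd W) where

  ⋃N : Pred W (Level.suc 0ℓ)
  ⋃N z = Σ W λ w → Σ (Subset W) λ X → (N w X) × (z ∈ X)

  -- z ∈ ⋂ N_z : N_z nonempty and z belongs to every member of N_z
  InOwnCore : Pred W (Level.suc 0ℓ)
  InOwnCore z = (Σ (Subset W) λ X → N z X) × (∀ X → N z X → z ∈ X)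

  W₁ : Pred W (Level.suc 0ℓ)
  W₁ = InOwnCore

  W₂ : Pred W (Level.suc 0ℓ)
  W₂ z = z ∉ ⋃N

  W₁with : Subset W → Pred W (Level.suc 0ℓ)
  W₁with X z = W₁ z × N z X

record GTNModel : Set₂ where
  field
    W    : Set
    inhabited : W
    N    : Nbhd W
    V    : PropVar → Subset W
    cover : ∀ z → W₁ N z ⊎ W₂ N z
    upward : ∀ w X Y → N w X → X ⊆ Y → Y ⊆ ⋃N N → N w Y
    core : ∀ w X → N w X → Σ (Subset W) λ Z → (Z ≐ W₁with N X) × N w Z

module _ (M : GTNModel) where
  open GTNModel M

  μ : Pred (Subset W) (Level.suc 0ℓ)
  μ X = (X ⊆ ⋃N N) × (∀ w → w ∈ X → N w X)

  ⋃μ : Pred W (Level.suc 0ℓ)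
  ⋃μ z = Σ (Subset W) λ X → μ X × (z ∈ X)

-- Every point z of ⋃N lies in W₁, so it has some neighbourhood Y. By (3) the set
-- Z = {u ∈ W₁ : Y ∈ N_u} is a neighbourhood of z, and z ∈ Z. Z belongs to μ:
-- for u ∈ Z we have Y ∈ N_u, so (3) at u makes the same set Z a neighbourhood of u.
module Submission where

open import Defs
open import Relation.Unary using (_∈_; _⊆_; _≐_)
open import Data.Product using (_×_; _,_; proj₂)
open import Data.Sum using (inj₁; inj₂)
open import Data.Empty using (⊥-elim)

module _ (M : GTNModel) where
  open GTNModel M

  neighbourhood⊆⋃N : ∀ {w X} → N w X → X ⊆ ⋃N N
  neighbourhood⊆⋃N {w} {X} X∈Nw z∈X = w , X , X∈Nw , z∈X

  ⋃N⊆W₁ : ⋃N N ⊆ W₁ N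
  ⋃N⊆W₁ {z} z∈⋃N with cover z
  ... | inj₁ z∈W₁ = z∈W₁
  ... | inj₂ z∉⋃N = ⊥-elim (z∉⋃N z∈⋃N)

  W₁with-neighbourhood∈μ : ∀ {w X Z} → Z ≐ W₁with N X → N w Z → μ M Z
  W₁with-neighbourhood∈μ {w} {X} {Z} (Z⊆ , ⊆Z) Z∈Nw = Z⊆⋃N , Z∈N-own
    where
    Z⊆⋃N : Z ⊆ ⋃N N
    Z⊆⋃N = neighbourhood⊆⋃N Z∈Nw

    Z∈N-own : ∀ u → u ∈ Z → N u Z
    Z∈N-own u u∈Z with core u X (proj₂ (Z⊆ u∈Z))
    ... | Z′ , (Z′⊆ , _) , Z′∈Nu = upward u Z′ Z Z′∈Nu (λ v∈Z′ → ⊆Z (Z′⊆ v∈Z′)) Z⊆⋃N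

  ⋃μ⊆⋃N : ⋃μ M ⊆ ⋃N N
  ⋃μ⊆⋃N (X , (X⊆⋃N , _) , z∈X) = X⊆⋃N z∈X

  ⋃N⊆⋃μ : ⋃N N ⊆ ⋃μ M
  ⋃N⊆⋃μ {z} z∈⋃N with ⋃N⊆W₁ z∈⋃N
  ... | z∈W₁@((Y , Y∈Nz) , _) with core z Y Y∈Nz
  ... | Z , Z≐ , Z∈Nz = Z , W₁with-neighbourhood∈μ Z≐ Z∈Nz , proj₂ Z≐ (z∈W₁ , Y∈Nz)

mainTheorem5 : (M : GTNModel) → (⋃μ M ⊆ ⋃N (GTNModel.N M)) × (⋃N (GTNModel.N M) ⊆ ⋃μ M)
mainTheorem5 M = ⋃μ⊆⋃N M , ⋃N⊆⋃μ M
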